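{- Let $c_1,c_1',c_2\in C$ be PIMP computations, $\rho,\rho'$ environments, $m,m'$ memories and $n\ge 0$ an integer. If $\langle c_1\rangle_k\langle\rho\rangle_{env}\langle m\rangle_{mem}\xrightarrow{L}^n\langle c_1'\rangle_k\langle\rho'\rangle_{env}\langle m'\rangle_{mem}$ (a sequence of $n$ derivable transitions, each labelled $P$ or $E$), then $\langle c_1;c_2\rangle_k\langle\rho\rangle_{env}\langle m\rangle_{mem}\xrightarrow{L}^n\langle c_1';c_2\rangle_k\langle\rho'\rangle_{env}\langle m'\rangle_{mem}$.
   Context: PIMP syntax. Arithmetic expressions $E::=0\mid1\mid2\mid\cdots\mid Var\mid -E\mid E_1+E_2\mid E_1-E_2\mid E_1*E_2\mid E_1\div E_2\mid E_1\bmod E_2$; boolean expressions $B::=true\mid false\mid E_1=E_2\mid E_1\neq E_2\mid E_1<E_2\mid E_1>E_2$. Atomic-block computations $CC::= Var:=E\mid if\,(B)\,CC_1\,else\,CC_2\mid CC_1;CC_2\mid Var:=Array(e_1,\dots,e_n)\mid Var[E_1]:=E_2\mid Var_1:=Var_2[E]\mid skip$. Computations $C::= Var:=E\mid if\,(B)\,C_1\,else\,C_2\mid C_1;C_2\mid while\;B\;do\;C\mid C_1\parallel C_2\mid await\;B\;then\;CC\mid skip\mid Var:=Array(e_1,\dots,e_n)\mid Var[E_1]:=E_2\mid Var_1:=Var_2[E]$. There is an empty computation $\cdot$ with $\cdot\,;c=c$ and $\cdot\parallel c=c=c\parallel\cdot$. A configuration is $\langle c\rangle_k\langle\rho\rangle_{env}\langle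 m\rangle_{mem}$ where $\rho$ is a finite partial map from program variables to integers and $m$ a finite partial map from positive naturals to integers; $\rho(e)$, $\rho(b)$ denote evaluation in $\rho$. Transitions are labelled $P$ (program step) or $E$ (environment step), generated by the rules (writing $\langle c\rangle\langle\rho\rangle\langle m\rangle$ for $\langle c\rangle_k\langle\rho\rangle_{env}\langle m\rangle_{mem}$): SKIP $\langle skip\rangle\langle\rho\rangle\langle m\rangle\xrightarrow{P}\langle\cdot\rangle\langle\rho\rangle\langle m\rangle$; SEQ: if $\langle c_1\rangle\langle\rho\rangle\langle m\rangle\xrightarrow{P}\langle c_1'\rangle\langle\rho'\rangle\langle m'\rangle$ then $\langle c_1;c_2\rangle\langle\rho\rangle\langle m\rangle\xrightarrow{P}\langle c_1';c_2\rangle\langle\rho'\rangle\langle m'\rangle$; ASGN1 $\langle x:=e\rangle\langle\rho\rangle\langle m\rangle\xrightarrow{P}\langle\cdot\rangle\langle\rho[\rho(e)/x]\rangle\langle m\rangle$; ASGN2 $\langle x:=A[e]\rangle\langle\rho\rangle\langle m\rangle\xrightarrow{P}\langle\cdot\rangle\langle\rho[m(\rho(A)+\rho(e))/x]\rangle\langle m\rangle$; ASGN3 $\langle A[e_1]:=e_2\rangle\langle\rho\rangle\langle m\rangle\xrightarrow{P}\langle\cdot\rangle\langle\rho\rangle\langle m[\rho(e_2)/(\rho(A)+\rho(e_1))]\rangle$; ARRAY $\langle A:=Array(e_1,\dots,e_n)\rangle\langle\rho\rangle\langle m\rangle\xrightarrow{P}\langle\cdot\rangle\langle\rho[p/A]\rangle\langle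 p\mapsto\rho(e_1),\dots,p+n-1\mapsto\rho(e_n),m\rangle$ for any positive integer $p$ making this a well-formed map; IF1/IF2: $\langle if\,(b)\,c_1\,else\,c_2\rangle\langle\rho\rangle\langle m\rangle\xrightarrow{P}\langle c_1\rangle\langle\rho\rangle\langle m\rangle$ if $\rho(b)$ is true, resp. $\to\langle c_2\rangle\langle\rho\rangle\langle m\rangle$ if false; WHILE1/WHILE2: $\langle while\;b\;do\;c\rangle\langle\rho\rangle\langle m\rangle\xrightarrow{P}\langle c;while\;b\;do\;c\rangle\langle\rho\rangle\langle m\rangle$ if $\rho(b)$ true, resp. $\to\langle\cdot\rangle\langle\rho\rangle\langle m\rangle$ if false; AWAIT: if $\rho(b)$ is true and $\langle cc\rangle\langle\rho\rangle\langle m\rangle\xrightarrow{P}^*\langle\cdot\rangle\langle\rho'\rangle\langle m'\rangle$ then $\langle await\;b\;then\;cc\rangle\langle\rho\rangle\langle m\rangle\xrightarrow{P}\langle\cdot\rangle\langle\rho'\rangle\langle m'\rangle$; PAR1/PAR2: a $P$-step of $c_1$ (resp. $c_2$) yields the corresponding $P$-step of $c_1\parallel c_2$ with the other component unchanged; ENV: $\langle c\rangle\langle\rho\rangle\langle m\rangle\xrightarrow{E}\langle c\rangle\langle\rho'\rangle\langle m'\rangle$ for arbitrary $\rho',m'$. $\xrightarrow{L}^n$ denotes $n$ consecutive such transitions, each labelled $P$ or $E$. -}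

module Defs where

open import Data.Nat as ℕ using (ℕ; zero; suc; _<_; _≤_)
open import Data.Integer as ℤ using (ℤ; +_; -[1+_]; 0ℤ)
open import Data.Bool using (Bool; true; false)
open import Data.Maybe using (Maybe; just; nothing; _>>=_)
open import Data.List using (List; []; _∷_; length)
open import Relation.Binary.PropositionalEquality using (_≡_)
open import Relation.Nullary using (yes; no)
open import Relation.Nullary.Decidable using (⌊_⌋)

Var : Set
Var = ℕ

data AExp : Set where
  lit   : ℕ → AExp
  var   : Var → AExp
  neg   : AExp → AExp
  _⊕_   : AExp → AExp → AExp
  _⊖_   : AExp → AExp → AExp
  _⊛_   : AExp → AExp → AExp
  _⊘_   : AExp → AExp → AExp
  _⊜_   : AExp → AExp → AExp

data BExp : Set where
  btrue bfalse : BExp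
  _=ᵇ_ _≠ᵇ_ _<ᵇ_ _>ᵇ_ : AExp → AExp → BExp

data AComp : Set where
  _≔_      : Var → AExp → AComp
  if_then_else_ : BExp → AComp → AComp → AComp
  _⨾_      : AComp → AComp → AComp
  _≔Array_ : Var → List AExp → AComp
  _[_]≔_   : Var → AExp → AExp → AComp
  _≔_[_]   : Var → Var → AExp → AComp
  skip     : AComp

data Comp : Set where
  _≔_      : Var → AExp → Comp
  if_then_else_ : BExp → Comp → Comp → Comp
  _⨾_      : Comp → Comp → Comp
  while_loop_ : BExp → Comp → Comp
  _∥_      : Comp → Comp → Comp
  await_then_ : BExp → AComp → Comp
  skip     : Comp
  _≔Array_ : Var → List AExp → Comp
  _[_]≔_   : Var → AExp → AExp → Comp
  _≔_[_]   : Var → Var → AExp → Comp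

embed : AComp → Comp
embed (x ≔ e) = x ≔ e
embed (if b then c₁ else c₂) = if b then embed c₁ else embed c₂
embed (c₁ ⨾ c₂) = embed c₁ ⨾ embed c₂
embed (x ≔Array es) = x ≔Array es
embed (a [ e₁ ]≔ e₂) = a [ e₁ ]≔ e₂
embed (x ≔ a [ e ]) = x ≔ a [ e ]
embed skip = skip

-- Contents of the k-cell: either the empty computation · or a computation.
data K : Set where
  ·   : K
  run : Comp → K

seqK : K → Comp → K
seqK ·       c₂ = run c₂
seqK (run c) c₂ = run (c ⨾ c₂)

parK : K → K → K
parK ·        k        = k
parK (run c₁) ·        = run c₁
parK (run c₁) (run c₂) = run (c₁ ∥ c₂)

Env : Set
Env = Var → Maybe ℤ

Mem : Set
Mem = ℕ → Maybe ℤ      -- only positive addresses are ever used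

updEnv : Env → Var → ℤ → Env
updEnv ρ x v y with x ℕ.≟ y
... | yes _ = just v
... | no  _ = ρ y

updMem : Mem → ℕ → ℤ → Mem
updMem m p v q with p ℕ.≟ q
... | yes _ = just v
... | no  _ = m q

alloc : ℕ → List ℤ → Mem → Mem
alloc p []       m = m
alloc p (v ∷ vs) m = updMem (alloc (suc p) vs m) p v

toAddr : ℤ → Maybe ℕ
toAddr (+ suc n) = just (suc n)
toAddr _         = nothing

divZ : ℤ → ℤ → Maybe ℤ
divZ i (+ zero)    = nothing
divZ i (+ suc n)   = just (i ℤ./ (+ suc n))
divZ i (-[1+ n ])  = just (i ℤ./ -[1+ n ])

modZ : ℤ → ℤ → Maybe ℤ
modZ i (+ zero)    = nothing
modZ i (+ suc n)   = just (+ (i ℤ.% (+ suc n)))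
modZ i (-[1+ n ])  = just (+ (i ℤ.% -[1+ n ]))

evalA : Env → AExp → Maybe ℤ
evalA ρ (lit n)   = just (+ n)
evalA ρ (var x)   = ρ x
evalA ρ (neg e)   = evalA ρ e >>= λ v → just (ℤ.- v)
evalA ρ (e₁ ⊕ e₂) = evalA ρ e₁ >>= λ a → evalA ρ e₂ >>= λ b → just (a ℤ.+ b)
evalA ρ (e₁ ⊖ e₂) = evalA ρ e₁ >>= λ a → evalA ρ e₂ >>= λ b → just (a ℤ.- b)
evalA ρ (e₁ ⊛ e₂) = evalA ρ e₁ >>= λ a → evalA ρ e₂ >>= λ b → just (a ℤ.* b)
evalA ρ (e₁ ⊘ e₂) = evalA ρ e₁ >>= λ a → evalA ρ e₂ >>= λ b → divZ a b
evalA ρ (e₁ ⊜ e₂) = evalA ρ e₁ >>= λ a → evalA ρ e₂ >>= λ b → modZ a b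

evalB : Env → BExp → Maybe Bool
evalB ρ btrue      = just true
evalB ρ bfalse     = just false
evalB ρ (e₁ =ᵇ e₂) = evalA ρ e₁ >>= λ a → evalA ρ e₂ >>= λ b → just ⌊ a ℤ.≟ b ⌋
evalB ρ (e₁ ≠ᵇ e₂) = evalA ρ e₁ >>= λ a → evalA ρ e₂ >>= λ b →
                       just (Data.Bool.not ⌊ a ℤ.≟ b ⌋)
  where import Data.Bool
evalB ρ (e₁ <ᵇ e₂) = evalA ρ e₁ >>= λ a → evalA ρ e₂ >>= λ b → just ⌊ a ℤ.<? b ⌋
evalB ρ (e₁ >ᵇ e₂) = evalA ρ e₁ >>= λ a → evalA ρ e₂ >>= λ b → just ⌊ b ℤ.<? a ⌋

evalList : Env → List AExp → Maybe (List ℤ)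
evalList ρ []       = just []
evalList ρ (e ∷ es) = evalA ρ e >>= λ v → evalList ρ es >>= λ vs → just (v ∷ vs)

mutual
  data PStep : K → Env → Mem → K → Env → Mem → Set where
    SKIP  : ∀ {ρ m} → PStep (run skip) ρ m · ρ m
    SEQ   : ∀ {c₁ c₂ k ρ m ρ' m'} →
            PStep (run c₁) ρ m k ρ' m' →
            PStep (run (c₁ ⨾ c₂)) ρ m (seqK k c₂) ρ' m'
    ASGN1 : ∀ {x e v ρ m} → evalA ρ e ≡ just v →
            PStep (run (x ≔ e)) ρ m · (updEnv ρ x v) m
    ASGN2 : ∀ {x A e a i p v ρ m} →
            ρ A ≡ just a → evalA ρ e ≡ just i →
            toAddr (a ℤ.+ i) ≡ just p → m p ≡ just v →
            PStep (run (x ≔ A [ e ])) ρ m · (updEnv ρ x v) m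
    ASGN3 : ∀ {A e₁ e₂ a i v p ρ m} →
            ρ A ≡ just a → evalA ρ e₁ ≡ just i → evalA ρ e₂ ≡ just v →
            toAddr (a ℤ.+ i) ≡ just p →
            PStep (run (A [ e₁ ]≔ e₂)) ρ m · ρ (updMem m p v)
    ARRAY : ∀ {A es vs ρ m} (p : ℕ) → 1 ≤ p →
            (∀ i → i < length es → m (p ℕ.+ i) ≡ nothing) →
            evalList ρ es ≡ just vs →
            PStep (run (A ≔Array es)) ρ m · (updEnv ρ A (+ p)) (alloc p vs m)
    IF1   : ∀ {b c₁ c₂ ρ m} → evalB ρ b ≡ just true →
            PStep (run (if b then c₁ else c₂)) ρ m (run c₁) ρ m
    IF2   : ∀ {b c₁ c₂ ρ m} → evalB ρ b ≡ just false →
            PStep (run (if b then c₁ else c₂)) ρ m (run c₂) ρ m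
    WHILE1 : ∀ {b c ρ m} → evalB ρ b ≡ just true →
            PStep (run (while b loop c)) ρ m (run (c ⨾ (while b loop c))) ρ m
    WHILE2 : ∀ {b c ρ m} → evalB ρ b ≡ just false →
            PStep (run (while b loop c)) ρ m · ρ m
    AWAIT : ∀ {b cc ρ m ρ' m'} → evalB ρ b ≡ just true →
            PStar (run (embed cc)) ρ m · ρ' m' →
            PStep (run (await b then cc)) ρ m · ρ' m'
    PAR1  : ∀ {c₁ c₂ k ρ m ρ' m'} →
            PStep (run c₁) ρ m k ρ' m' →
            PStep (run (c₁ ∥ c₂)) ρ m (parK k (run c₂)) ρ' m'
    PAR2  : ∀ {c₁ c₂ k ρ m ρ' m'} →
            PStep (run c₂) ρ m k ρ' m' →
            PStep (run (c₁ ∥ c₂)) ρ m (parK (run c₁) k) ρ' m'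

  data PStar : K → Env → Mem → K → Env → Mem → Set where
    done : ∀ {k ρ m} → PStar k ρ m k ρ m
    step : ∀ {k ρ m k₁ ρ₁ m₁ k₂ ρ₂ m₂} →
           PStep k ρ m k₁ ρ₁ m₁ → PStar k₁ ρ₁ m₁ k₂ ρ₂ m₂ →
           PStar k ρ m k₂ ρ₂ m₂

data Label : Set where
  P E : Label

data Step : Label → K → Env → Mem → K → Env → Mem → Set where
  prog : ∀ {k ρ m k' ρ' m'} → PStep k ρ m k' ρ' m' → Step P k ρ m k' ρ' m'
  ENV  : ∀ {k ρ m} (ρ' : Env) (m' : Mem) → Step E k ρ m k ρ' m'

data Steps : ℕ → K → Env → Mem → K → Env → Mem → Set where
  zero : ∀ {k ρ m} → Steps 0 k ρ m k ρ m
  suc  : ∀ {n l k ρ m k₁ ρ₁ m₁ k₂ ρ₂ m₂} →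
         Step l k ρ m k₁ ρ₁ m₁ → Steps n k₁ ρ₁ m₁ k₂ ρ₂ m₂ →
         Steps (suc n) k ρ m k₂ ρ₂ m₂

{-# OPTIONS --safe #-}
module Submission where

open import Defs
open import Data.Nat using (ℕ)

-- A P-step never starts from the empty computation, so matching the source
-- as  run c  is exhaustive and puts it in the scope of SEQ.
seqK-step : ∀ {l k ρ m k' ρ' m'} (c₂ : Comp) → Step l k ρ m k' ρ' m' →
            Step l (seqK k c₂) ρ m (seqK k' c₂) ρ' m'
seqK-step c₂ (prog {k = run c} s) = prog (SEQ s)
seqK-step c₂ (ENV ρ' m')          = ENV ρ' m'

seqK-steps : ∀ {n k ρ m k' ρ' m'} (c₂ : Comp) → Steps n k ρ m k' ρ' m' →
             Steps n (seqK k c₂) ρ m (seqK k' c₂) ρ' m'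
seqK-steps c₂ zero       = zero
seqK-steps c₂ (suc s ss) = suc (seqK-step c₂ s) (seqK-steps c₂ ss)

lemma4 : (n : ℕ) (c₁ c₁' c₂ : Comp) (ρ ρ' : Env) (m m' : Mem) →
         Steps n (run c₁) ρ m (run c₁') ρ' m' →
         Steps n (run (c₁ ⨾ c₂)) ρ m (run (c₁' ⨾ c₂)) ρ' m'
lemma4 n c₁ c₁' c₂ ρ ρ' m m' = seqK-steps c₂
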